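{- Let $G$ be a finite abelian group and let $J\subset G$ with $0\in J$. Suppose there exist $g\in G$ and a positive integer $m$ such that the order of $g$ is at least $m+1$ and $\{0,g,2g,\ldots,mg\}\subset J$. Then for every positive integer $N$, $$D_G(J,N)\le \frac{|G|^N}{mN+1}.$$
   Context: For a finite abelian group $G$ (written additively), a subset $J\subset G$ with $0\in J$, and a positive integer $N$, $D_G(J,N)$ denotes the maximum size of a set $A\subset G^N$ such that $(A-A)\cap J^N=\{\mathbf{0}\}$, where $G^N,J^N$ are $N$-fold Cartesian products. -}

module Defs where

open import Level using (0ℓ)
open import Data.Nat using (ℕ; zero; suc; _+_; _*_; _^_; _≤_; _<_)
open import Data.Fin using (Fin)
open import Data.Vec using (Vec; lookup)
open import Data.List using (List; length)
open import Data.List.Membership.Propositional using (_∈_)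
open import Data.List.Relation.Unary.Unique.Propositional using (Unique)
open import Data.Product using (_×_; Σ; ∃-syntax)
open import Relation.Binary.PropositionalEquality using (_≡_; _≢_)
open import Algebra.Structures using (IsAbelianGroup)

-- A finite abelian group of order n, presented (up to isomorphism) on the
-- carrier Fin n with propositional equality.
record FinAbGroup (n : ℕ) : Set where
  field
    _⊕_   : Fin n → Fin n → Fin n
    𝟘     : Fin n
    ⊖_    : Fin n → Fin n
    isAbelianGroup : IsAbelianGroup _≡_ _⊕_ 𝟘 ⊖_

  infixl 6 _⊕_ _⊝_
  _⊝_ : Fin n → Fin n → Fin n
  x ⊝ y = x ⊕ (⊖ y)

  _·_ : ℕ → Fin n → Fin n
  zero  · g = 𝟘
  suc k · g = g ⊕ (k · g)

  IsOrder : Fin n → ℕ → Set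
  IsOrder g k = (0 < k) × (k · g ≡ 𝟘) × (∀ j → 0 < j → j < k → j · g ≢ 𝟘)

module _ {n : ℕ} (G : FinAbGroup n) where
  open FinAbGroup G

  DiffIn : (J : Fin n → Set) {N : ℕ} → Vec (Fin n) N → Vec (Fin n) N → Set
  DiffIn J {N} a b = ∀ (i : Fin N) → J (lookup a i ⊝ lookup b i)

  -- A ⊆ G^N (a duplicate-free list) with (A - A) ∩ J^N = {0}:
  -- whenever a - b ∈ J^N for a, b ∈ A, we have a = b.
  Admissible : (J : Fin n → Set) (N : ℕ) → List (Vec (Fin n) N) → Set
  Admissible J N A =
    Unique A × (∀ {a b} → a ∈ A → b ∈ A → DiffIn J a b → a ≡ b)

-- Translating each a ∈ A along the staircase path 0 = b(0), b(1), …, b(mN) = (mg, …, mg),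
-- which raises one coordinate at a time by g, yields |A|(mN + 1) points of G^N that are
-- pairwise distinct: a + b(t) = a' + b(s) with s ≤ t puts a' − a = b(t) − b(s) in J^N, so
-- a = a', and then b(t) = b(s) forces t = s because kg ≠ k'g for distinct k, k' ≤ m.
module Submission where

open import Defs
open import Level using (0ℓ)
open import Data.Nat using (ℕ; zero; suc; _+_; _*_; _^_; _≤_; _<_; _∸_; _⊓_; _≤?_; s≤s)
open import Data.Nat.Properties
open import Data.Fin using (Fin; toℕ; fromℕ<; remQuot; combine; funToFin; finToFun)
open import Data.Fin.Properties
  using (toℕ<n; toℕ-fromℕ<; toℕ-injective; injective⇒≤; combine-remQuot; finToFun-funToFin)
open import Data.Vec using (Vec; lookup)
open import Data.List using (List; length)
import Data.List as List
open import Data.List.Membership.Propositional using (_∈_)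
open import Data.List.Membership.Propositional.Properties using (∈-lookup)
open import Data.List.Relation.Unary.Unique.Propositional using (Unique)
open import Data.List.Relation.Unary.AllPairs using (_∷_)
import Data.List.Relation.Unary.All as All
open import Data.Product using (_×_; Σ; _,_; proj₁; proj₂; uncurry; ∃-syntax)
open import Data.Product.Properties using (×-≡,≡→≡)
open import Data.Sum using (inj₁; inj₂)
open import Relation.Nullary using (yes; no; contradiction)
open import Relation.Binary.Definitions using (tri<; tri≈; tri>)
open import Relation.Binary.PropositionalEquality
open import Algebra.Bundles using (AbelianGroup)
import Algebra.Properties.AbelianGroup as AbelianGroupProperties

Unique⇒lookup-injective : ∀ {A : Set} {xs : List A} → Unique xs →
                          ∀ {i j} → List.lookup xs i ≡ List.lookup xs j → i ≡ j
Unique⇒lookup-injective (_  ∷ _) {Fin.zero}  {Fin.zero}  _  = refl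
Unique⇒lookup-injective (x∉ ∷ _) {Fin.zero}  {Fin.suc j} eq = contradiction eq (All.lookup x∉ (∈-lookup j))
Unique⇒lookup-injective (x∉ ∷ _) {Fin.suc i} {Fin.zero}  eq = contradiction (sym eq) (All.lookup x∉ (∈-lookup i))
Unique⇒lookup-injective (_  ∷ u) {Fin.suc i} {Fin.suc j} eq = cong Fin.suc (Unique⇒lookup-injective u eq)

pairing-injective⇒≤ : ∀ {a b n N} (f : Fin a → Fin b → Fin N → Fin n) →
                      (∀ {i j t s} → (∀ c → f i t c ≡ f j s c) → i ≡ j × t ≡ s) →
                      a * b ≤ n ^ N
pairing-injective⇒≤ {a} {b} {n} {N} f f-injective = injective⇒≤ encode-injective
  where
  encode : Fin (a * b) → Fin (n ^ N)
  encode z = funToFin (uncurry f (remQuot {a} b z))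

  encode-injective : ∀ {z z′} → encode z ≡ encode z′ → z ≡ z′
  encode-injective {z} {z′} eq = begin
    z                                    ≡⟨ combine-remQuot {a} b z ⟨
    uncurry combine (remQuot {a} b z)    ≡⟨ cong (uncurry combine) (×-≡,≡→≡ (f-injective pointwise)) ⟩
    uncurry combine (remQuot {a} b z′)   ≡⟨ combine-remQuot {a} b z′ ⟩
    z′                                   ∎
    where
    open ≡-Reasoning
    pointwise : ∀ c → uncurry f (remQuot {a} b z) c ≡ uncurry f (remQuot {a} b z′) c
    pointwise c = begin
      uncurry f (remQuot {a} b z) c    ≡⟨ finToFun-funToFin _ c ⟨
      finToFun (encode z) c            ≡⟨ cong (λ w → finToFun w c) eq ⟩
      finToFun (encode z′) c           ≡⟨ finToFun-funToFin _ c ⟩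
      uncurry f (remQuot {a} b z′) c   ∎

-- Coordinate c of the staircase path climbs from 0 to m during the times c·m, …, c·m + m.
staircase : ℕ → ℕ → ℕ → ℕ
staircase m c t = (t ∸ c * m) ⊓ m

staircase-≤ : ∀ m c t → staircase m c t ≤ m
staircase-≤ m c t = m⊓n≤n _ m

staircase-mono : ∀ m c {s t} → s ≤ t → staircase m c s ≤ staircase m c t
staircase-mono m c s≤t = ⊓-monoˡ-≤ m (∸-monoˡ-≤ (c * m) s≤t)

staircase-rises-in-block : ∀ m c {s t} → s < t → c * m < t → t ≤ c * m + m →
                           staircase m c s < staircase m c t
staircase-rises-in-block m c {s} {t} s<t cm<t t≤ = begin-strict
  staircase m c s  ≤⟨ m⊓n≤m (s ∸ c * m) m ⟩
  s ∸ c * m        <⟨ ∸-monoˡ-<′ ⟩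
  t ∸ c * m        ≡⟨ m≤n⇒m⊓n≡m (m≤n+o⇒m∸n≤o t (c * m) t≤) ⟨
  staircase m c t  ∎
  where
  open ≤-Reasoning
  ∸-monoˡ-<′ : s ∸ c * m < t ∸ c * m
  ∸-monoˡ-<′ with c * m ≤? s
  ... | yes cm≤s = ∸-monoˡ-< s<t cm≤s
  ... | no  cm≰s = subst (_< t ∸ c * m) (sym (m≤n⇒m∸n≡0 (≰⇒≥ cm≰s))) (m<n⇒0<n∸m cm<t)

staircase-separates : ∀ m N {s t} → s < t → t ≤ N * m →
                      ∃[ c ] c < N × staircase m c s < staircase m c t
staircase-separates m zero    s<t t≤0 = contradiction (<-≤-trans s<t t≤0) n≮0
staircase-separates m (suc N) {s} {t} s<t t≤ with t ≤? N * m
... | yes t≤Nm = let c , c<N , rises = staircase-separates m N s<t t≤Nm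
                 in c , m<n⇒m<1+n c<N , rises
... | no  t≰Nm = N , ≤-refl ,
                 staircase-rises-in-block m N s<t (≰⇒> t≰Nm) (≤-trans t≤ (≤-reflexive (+-comm m (N * m))))

staircase-injective : ∀ m N {s t} → s ≤ t → t ≤ N * m →
                      (∀ (c : Fin N) → staircase m (toℕ c) t ≡ staircase m (toℕ c) s) → t ≡ s
staircase-injective m N {s} {t} s≤t t≤ same with m≤n⇒m<n∨m≡n s≤t
... | inj₂ s≡t = sym s≡t
... | inj₁ s<t with c , c<N , rises ← staircase-separates m N s<t t≤ =
  contradiction (subst (λ i → staircase m i t ≡ staircase m i s) (toℕ-fromℕ< c<N) (same (fromℕ< c<N)))
                (≢-sym (<⇒≢ rises))

module _ {n : ℕ} (G : FinAbGroup n) where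
  open FinAbGroup G

  private
    abelianGroup : AbelianGroup 0ℓ 0ℓ
    abelianGroup = record { isAbelianGroup = isAbelianGroup }

  open AbelianGroup abelianGroup using (assoc; comm; identityˡ)
  open AbelianGroupProperties abelianGroup using (∙-cancelˡ; ∙-cancelʳ; x≈z//y)

  ·-homo-+ : ∀ p q g → (p + q) · g ≡ p · g ⊕ q · g
  ·-homo-+ zero    q g = sym (identityˡ (q · g))
  ·-homo-+ (suc p) q g = trans (cong (g ⊕_) (·-homo-+ p q g)) (sym (assoc g (p · g) (q · g)))

  x⊕[y⊕z]≡w⊕z⇒w⊝x≡y : ∀ x y z w → x ⊕ (y ⊕ z) ≡ w ⊕ z → w ⊝ x ≡ y
  x⊕[y⊕z]≡w⊕z⇒w⊝x≡y x y z w eq = sym (x≈z//y y x w y⊕x≡w)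
    where
    y⊕x≡w : y ⊕ x ≡ w
    y⊕x≡w = trans (comm y x) (∙-cancelʳ z (x ⊕ y) w (trans (assoc x y z) eq))

  ·-distinct-below-order : ∀ {g k} → IsOrder g k → ∀ {p q} → p < q → q < k → p · g ≢ q · g
  ·-distinct-below-order {g} (_ , _ , minimal) {p} {q} p<q q<k eq =
    minimal (q ∸ p) (m<n⇒0<n∸m p<q) (≤-<-trans (m∸n≤m q p) q<k)
      (∙-cancelʳ (p · g) ((q ∸ p) · g) 𝟘 (begin
        (q ∸ p) · g ⊕ p · g   ≡⟨ ·-homo-+ (q ∸ p) p g ⟨
        (q ∸ p + p) · g       ≡⟨ cong (_· g) (m∸n+n≡m (<⇒≤ p<q)) ⟩
        q · g                 ≡⟨ eq ⟨
        p · g                 ≡⟨ identityˡ (p · g) ⟨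
        𝟘 ⊕ p · g             ∎))
    where open ≡-Reasoning

  ·-injective-below-order : ∀ {g k} → IsOrder g k → ∀ {p q} → p < k → q < k → p · g ≡ q · g → p ≡ q
  ·-injective-below-order order {p} {q} p<k q<k eq with <-cmp p q
  ... | tri< p<q _ _ = contradiction eq (·-distinct-below-order order p<q q<k)
  ... | tri≈ _ p≡q _ = p≡q
  ... | tri> _ _ q<p = contradiction (sym eq) (·-distinct-below-order order q<p p<k)

  module _ (g : Fin n) (m : ℕ) where

    point : ∀ {N} → Vec (Fin n) N → ℕ → Fin N → Fin n
    point a t c = lookup a c ⊕ staircase m (toℕ c) t · g

    point-difference : ∀ {N} (a b : Vec (Fin n) N) {s t} c → s ≤ t → point a t c ≡ point b s c →
                       lookup b c ⊝ lookup a c ≡ (staircase m (toℕ c) t ∸ staircase m (toℕ c) s) · g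
    point-difference a b {s} {t} c s≤t eq =
      x⊕[y⊕z]≡w⊕z⇒w⊝x≡y (lookup a c) (rise · g) (lower · g) (lookup b c) (begin
        lookup a c ⊕ (rise · g ⊕ lower · g)   ≡⟨ cong (lookup a c ⊕_) (·-homo-+ rise lower g) ⟨
        lookup a c ⊕ (rise + lower) · g       ≡⟨ cong (λ k → lookup a c ⊕ k · g) (m∸n+n≡m lower≤upper) ⟩
        point a t c                           ≡⟨ eq ⟩
        point b s c                           ∎)
      where
      open ≡-Reasoning
      lower = staircase m (toℕ c) s
      upper = staircase m (toℕ c) t
      rise  = upper ∸ lower
      lower≤upper : lower ≤ upper
      lower≤upper = staircase-mono m (toℕ c) s≤t

    module _ (J : Fin n → Set) (J∋multiples : ∀ k → k ≤ m → J (k · g))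
             (injective : ∀ {p q} → p ≤ m → q ≤ m → p · g ≡ q · g → p ≡ q)
             {N : ℕ} {A : List (Vec (Fin n) N)} (admissible : Admissible G J N A) where

      points-collide⇒same : ∀ {a b s t} → a ∈ A → b ∈ A → s ≤ t → t ≤ N * m →
                            (∀ c → point a t c ≡ point b s c) → b ≡ a × t ≡ s
      points-collide⇒same {a} {b} {s} {t} a∈A b∈A s≤t t≤ eq =
        b≡a , staircase-injective m N s≤t t≤ same-height
        where
        b≡a : b ≡ a
        b≡a = proj₂ admissible b∈A a∈A λ c →
          subst J (sym (point-difference a b c s≤t (eq c)))
                (J∋multiples _ (≤-trans (m∸n≤m _ (staircase m (toℕ c) s)) (staircase-≤ m (toℕ c) t)))

        same-height : ∀ c → staircase m (toℕ c) t ≡ staircase m (toℕ c) s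
        same-height c = injective (staircase-≤ m (toℕ c) t) (staircase-≤ m (toℕ c) s)
          (∙-cancelˡ (lookup a c) _ _ (trans (eq c) (cong (λ v → point v s c) b≡a)))

      point-injective : ∀ {a b s t} → a ∈ A → b ∈ A → s ≤ N * m → t ≤ N * m →
                        (∀ c → point a t c ≡ point b s c) → a ≡ b × t ≡ s
      point-injective {s = s} {t} a∈A b∈A s≤ t≤ eq with ≤-total s t
      ... | inj₁ s≤t = let b≡a , t≡s = points-collide⇒same a∈A b∈A s≤t t≤ eq in sym b≡a , t≡s
      ... | inj₂ t≤s = let a≡b , s≡t = points-collide⇒same b∈A a∈A t≤s s≤ (λ c → sym (eq c)) in a≡b , sym s≡t

proposition2p9 : (n : ℕ) (G : FinAbGroup n) (J : Fin n → Set)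
    → J (FinAbGroup.𝟘 G)
    → (g : Fin n) (m : ℕ) → 1 ≤ m
    → Σ ℕ (λ k → FinAbGroup.IsOrder G g k × suc m ≤ k)
    → (∀ k → k ≤ m → J (FinAbGroup._·_ G k g))
    → (N : ℕ) → 1 ≤ N
    → (A : List (Vec (Fin n) N)) → Admissible G J N A
    → length A * (m * N + 1) ≤ n ^ N
proposition2p9 n G J _ g m _ (k , order , m<k) J∋multiples N _ A admissible =
  pairing-injective⇒≤ (λ i t → point G g m (List.lookup A i) (toℕ t)) pairing-injective
  where
  open FinAbGroup G using (_·_)

  injective : ∀ {p q} → p ≤ m → q ≤ m → p · g ≡ q · g → p ≡ q
  injective p≤m q≤m =
    ·-injective-below-order G order (<-≤-trans (s≤s p≤m) m<k) (<-≤-trans (s≤s q≤m) m<k)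

  time-bound : (t : Fin (m * N + 1)) → toℕ t ≤ N * m
  time-bound t = ≤-trans (m<1+n⇒m≤n (subst (toℕ t <_) (+-comm (m * N) 1) (toℕ<n t)))
                         (≤-reflexive (*-comm m N))

  pairing-injective : ∀ {i j t s} →
                      (∀ c → point G g m (List.lookup A i) (toℕ t) c ≡ point G g m (List.lookup A j) (toℕ s) c) →
                      i ≡ j × t ≡ s
  pairing-injective {i} {j} {t} {s} eq =
    let a≡b , t≡s = point-injective G g m J J∋multiples injective admissible
                      (∈-lookup i) (∈-lookup j) (time-bound s) (time-bound t) eq
    in Unique⇒lookup-injective (proj₁ admissible) a≡b , toℕ-injective t≡s
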